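{- Let $(V,d)$ be a finite metric with root $r\in V$ and let $\pi$ be any master tour on $(V,d)$ (a tour starting at $r$ visiting all vertices). Let $\{q_v\}_{v\in V}$ and $\{\bar p_v\}_{v\in V}$ satisfy $0\le q_v\le \bar p_v\le 1$ for each $v\in V$. Then the expected latency of $\pi$ under the independent activation probabilities $\{q_v\}$ is at most its expected latency under the independent activation probabilities $\{\bar p_v\}$.
   Context: Given independent activation probabilities $\{x_v\}_{v\in V}$, a random active set $A\subseteq V$ contains each $v$ independently with probability $x_v$. The tour $\pi_A$ visits the vertices of $A$ in the order of $\pi$, starting from $r$ and shortcutting over $V\setminus A$. For $v\in A$, $\mathsf{LAT}^A_\pi(v)$ is the length of the path along $\pi_A$ from $r$ to $v$. The expected latency of $\pi$ under $\{x_v\}$ is $\mathbb{E}_A\big[\sum_{v\in A}\mathsf{LAT}^A_\pi(v)\big]$.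
   Formalization: The distances d and the activation probabilities $\{q_v\}$ and $\{\bar p_v\}$ take values in the rationals rather than the reals. -}

module Defs where

open import Data.Nat using (ℕ; zero; suc)
open import Data.Bool using (Bool; true; false; if_then_else_; _∧_)
open import Data.Fin using (Fin; toℕ)
open import Data.Fin.Subset using (Subset)
open import Data.Vec using (Vec; []; _∷_; lookup)
open import Data.List using (List; []; _∷_; _++_; map; allFin; filterᵇ; foldr)
open import Data.Rational using (ℚ; 0ℚ; 1ℚ; _+_; _*_; _-_; _≤_)
open import Relation.Binary.PropositionalEquality using (_≡_)
open import Function.Bundles using (_↔_; Inverse)
import Data.Nat as ℕ

record IsMetric {m : ℕ} (d : Fin m → Fin m → ℚ) : Set where
  field
    nonneg : ∀ u v → 0ℚ ≤ d u v
    zero-diag : ∀ v → d v v ≡ 0ℚ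
    symmetric : ∀ u v → d u v ≡ d v u
    triangle : ∀ u v w → d u w ≤ d u v + d v w

-- A master tour on V = Fin m: a bijection from positions to vertices.
-- (to i) is the i-th vertex visited.
Tour : ℕ → Set
Tour m = Fin m ↔ Fin m

StartsAt : ∀ {n} → Tour (suc n) → Fin (suc n) → Set
StartsAt π r = Inverse.to π Fin.zero ≡ r
  where import Data.Fin as Fin

sumℚ : List ℚ → ℚ
sumℚ = foldr _+_ 0ℚ

prodℚ : List ℚ → ℚ
prodℚ = foldr _*_ 1ℚ

pathLength : ∀ {m} → (Fin m → Fin m → ℚ) → List (Fin m) → ℚ
pathLength d [] = 0ℚ
pathLength d (a ∷ []) = 0ℚ
pathLength d (a ∷ b ∷ rest) = d a b + pathLength d (b ∷ rest)

-- LAT^A_π(v): length of the path along π_A from r to v, where π_A visits the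
-- vertices of A in the order of π, starting at r, shortcutting V \ A.
LAT : ∀ {m} → (Fin m → Fin m → ℚ) → Fin m → Tour m → Subset m → Fin m → ℚ
LAT {m} d r π A v =
  pathLength d (r ∷ filterᵇ (λ u → lookup A u ∧ (toℕ (Inverse.from π u) ℕ.≤ᵇ toℕ (Inverse.from π v)))
                            (map (Inverse.to π) (allFin m)))

totalLatency : ∀ {m} → (Fin m → Fin m → ℚ) → Fin m → Tour m → Subset m → ℚ
totalLatency {m} d r π A =
  sumℚ (map (λ v → if lookup A v then LAT d r π A v else 0ℚ) (allFin m))

allSubsets : ∀ m → List (Subset m)
allSubsets zero = [] ∷ []
allSubsets (suc m) = map (true ∷_) (allSubsets m) ++ map (false ∷_) (allSubsets m)

probActive : ∀ {m} → (Fin m → ℚ) → Subset m → ℚ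
probActive {m} x A = prodℚ (map (λ v → if lookup A v then x v else 1ℚ - x v) (allFin m))

expectedLatency : ∀ {m} → (Fin m → Fin m → ℚ) → Fin m → Tour m → (Fin m → ℚ) → ℚ
expectedLatency {m} d r π x =
  sumℚ (map (λ A → probActive x A * totalLatency d r π A) (allSubsets m))

{-# OPTIONS --safe #-}
-- Enlarging the active set A only inserts vertices into each walk r → … → v of π_A, which by the
-- triangle inequality cannot shorten it, and adds non-negative latencies of new vertices; so the
-- total latency is a monotone function of A. For independent activations, the expectation of a
-- monotone set function F is monotone in every activation probability: conditioning on vertex v
-- gives p · E[F | v ∈ A] + (1 - p) · E[F | v ∉ A], a convex combination whose first term is the
-- larger one, and induction over the vertices finishes the argument.
module Submission where

open import Defs
open import Data.Bool using (Bool; true; false; T; T?; if_then_else_; _∧_)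
open import Data.Bool.Properties using (T-≡; T-∧)
open import Data.Empty using (⊥-elim)
open import Data.Fin using (Fin; zero; suc; toℕ)
open import Data.Fin.Subset using (Subset; _⊆_; inside; outside)
open import Data.Fin.Subset.Properties using (s⊆s; out⊆; ⊆-refl)
open import Data.List using (List; []; _∷_; _++_; map; filterᵇ; tabulate; allFin)
open import Data.List.Properties using (map-++; map-∘; map-cong; map-tabulate)
open import Data.List.Relation.Binary.Sublist.Propositional as Sublist using ([]; _∷ʳ_; _∷_)
open import Data.List.Relation.Binary.Sublist.Propositional.Properties using (filter⁺)
open import Data.Nat as ℕ using (ℕ; zero; suc)
open import Data.Product using (map₁)
open import Data.Rational using (ℚ; 0ℚ; 1ℚ; _≤_; _+_; _*_; _-_; -_; nonNegative)
open import Data.Rational.Properties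
  using (≤-refl; ≤-reflexive; ≤-trans; module ≤-Reasoning; nonNegative⁻¹;
         +-mono-≤; +-monoˡ-≤; +-monoʳ-≤; *-monoˡ-≤-nonNeg; *-monoʳ-≤-nonNeg;
         +-identityˡ; +-identityʳ; +-assoc; +-inverseʳ; *-assoc; *-zeroʳ; *-distribˡ-+)
open import Data.Rational.Solver using (module +-*-Solver)
open import Data.Vec using (_∷_; lookup)
open import Data.Vec.Properties using ([]=⇒lookup; lookup⇒[]=)
open import Function using (id; _∘_; Equivalence; Inverse)
open import Relation.Binary using (_Preserves_⟶_)
open import Relation.Binary.PropositionalEquality using (_≡_; refl; sym; trans; cong; cong₂; module ≡-Reasoning)

open Equivalence using (to; from)

private
  variable
    X : Set
    m : ℕ

sumℚ-++ : ∀ xs ys → sumℚ (xs ++ ys) ≡ sumℚ xs + sumℚ ys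
sumℚ-++ []       ys = sym (+-identityˡ (sumℚ ys))
sumℚ-++ (x ∷ xs) ys = trans (cong (x +_) (sumℚ-++ xs ys)) (sym (+-assoc x (sumℚ xs) (sumℚ ys)))

sumℚ-map-*ˡ : ∀ c (f : X → ℚ) xs → sumℚ (map (λ a → c * f a) xs) ≡ c * sumℚ (map f xs)
sumℚ-map-*ˡ c f []       = sym (*-zeroʳ c)
sumℚ-map-*ˡ c f (x ∷ xs) = trans (cong (c * f x +_) (sumℚ-map-*ˡ c f xs)) (sym (*-distribˡ-+ c _ _))

sumℚ-map-mono : ∀ {f g : X → ℚ} → (∀ a → f a ≤ g a) → ∀ xs → sumℚ (map f xs) ≤ sumℚ (map g xs)
sumℚ-map-mono f≤g []       = ≤-refl
sumℚ-map-mono f≤g (x ∷ xs) = +-mono-≤ (f≤g x) (sumℚ-map-mono f≤g xs)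

prodℚ-map-nonNeg : ∀ {f : X → ℚ} → (∀ a → 0ℚ ≤ f a) → ∀ xs → 0ℚ ≤ prodℚ (map f xs)
prodℚ-map-nonNeg 0≤f []       = nonNegative⁻¹ 1ℚ
prodℚ-map-nonNeg {f = f} 0≤f (x ∷ xs) = ≤-trans (≤-reflexive (sym (*-zeroʳ (f x))))
  (*-monoˡ-≤-nonNeg (f x) {{nonNegative (0≤f x)}} (prodℚ-map-nonNeg 0≤f xs))

p≤q⇒0≤q-p : ∀ {p q} → p ≤ q → 0ℚ ≤ q - p
p≤q⇒0≤q-p {p} p≤q = ≤-trans (≤-reflexive (sym (+-inverseʳ p))) (+-monoˡ-≤ (- p) p≤q)

mix : ℚ → ℚ → ℚ → ℚ
mix p a b = p * a + (1ℚ - p) * b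

mix-mono-≤ : ∀ {p a a′ b b′} → 0ℚ ≤ p → p ≤ 1ℚ → a ≤ a′ → b ≤ b′ → mix p a b ≤ mix p a′ b′
mix-mono-≤ {p} 0≤p p≤1 a≤a′ b≤b′ =
  +-mono-≤ (*-monoˡ-≤-nonNeg p {{nonNegative 0≤p}} a≤a′)
           (*-monoˡ-≤-nonNeg (1ℚ - p) {{nonNegative (p≤q⇒0≤q-p p≤1)}} b≤b′)

mix-monoˡ-≤ : ∀ {p p′ a b} → b ≤ a → p ≤ p′ → mix p a b ≤ mix p′ a b
mix-monoˡ-≤ {p} {p′} {a} {b} b≤a p≤p′ = begin
  mix p a b        ≡⟨ mix-shift p ⟩
  b + p * (a - b)  ≤⟨ +-monoʳ-≤ b (*-monoʳ-≤-nonNeg (a - b) {{nonNegative (p≤q⇒0≤q-p b≤a)}} p≤p′) ⟩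
  b + p′ * (a - b) ≡⟨ mix-shift p′ ⟨
  mix p′ a b       ∎
  where
  open ≤-Reasoning
  open +-*-Solver
  mix-shift : ∀ z → mix z a b ≡ b + z * (a - b)
  mix-shift z = solve 3 (λ z a b → z :* a :+ (con 1ℚ :- z) :* b := b :+ z :* (a :- b)) refl z a b

bernoulli : ℚ → Bool → ℚ
bernoulli p b = if b then p else 1ℚ - p

probActive-∷ : ∀ (x : Fin (suc m) → ℚ) b A →
               probActive x (b ∷ A) ≡ bernoulli (x zero) b * probActive (x ∘ suc) A
probActive-∷ x b A = cong (bernoulli (x zero) b *_) (cong prodℚ
  (trans (map-tabulate suc f) (sym (map-tabulate id (f ∘ suc)))))
  where
  f = λ v → bernoulli (x v) (lookup (b ∷ A) v)

probActive-nonNeg : ∀ {x : Fin m → ℚ} → (∀ v → 0ℚ ≤ x v) → (∀ v → x v ≤ 1ℚ) →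
                    ∀ A → 0ℚ ≤ probActive x A
probActive-nonNeg {m} {x} 0≤x x≤1 A = prodℚ-map-nonNeg bernoulli-nonNeg (allFin m)
  where
  bernoulli-nonNeg : ∀ v → 0ℚ ≤ bernoulli (x v) (lookup A v)
  bernoulli-nonNeg v with lookup A v
  ... | true  = 0≤x v
  ... | false = p≤q⇒0≤q-p (x≤1 v)

expectation : (Fin m → ℚ) → (Subset m → ℚ) → ℚ
expectation {m} x F = sumℚ (map (λ A → probActive x A * F A) (allSubsets m))

expectation-∷ : ∀ (x : Fin (suc m) → ℚ) F →
                expectation x F ≡ mix (x zero) (expectation (x ∘ suc) (F ∘ (inside ∷_)))
                                               (expectation (x ∘ suc) (F ∘ (outside ∷_)))
expectation-∷ {m} x F = begin
  sumℚ (map w (map (true ∷_) S ++ map (false ∷_) S))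
    ≡⟨ cong sumℚ (map-++ w (map (true ∷_) S) (map (false ∷_) S)) ⟩
  sumℚ (map w (map (true ∷_) S) ++ map w (map (false ∷_) S))
    ≡⟨ sumℚ-++ (map w (map (true ∷_) S)) (map w (map (false ∷_) S)) ⟩
  sumℚ (map w (map (true ∷_) S)) + sumℚ (map w (map (false ∷_) S))
    ≡⟨ cong₂ _+_ (conditioned true) (conditioned false) ⟩
  mix (x zero) (expectation (x ∘ suc) (F ∘ (inside ∷_))) (expectation (x ∘ suc) (F ∘ (outside ∷_))) ∎
  where
  open ≡-Reasoning
  S = allSubsets m
  w = λ A → probActive x A * F A
  conditioned : ∀ b → sumℚ (map w (map (b ∷_) S)) ≡
                      bernoulli (x zero) b * expectation (x ∘ suc) (F ∘ (b ∷_))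
  conditioned b = begin
    sumℚ (map w (map (b ∷_) S))
      ≡⟨ cong sumℚ (sym (map-∘ S)) ⟩
    sumℚ (map (w ∘ (b ∷_)) S)
      ≡⟨ cong sumℚ (map-cong factor S) ⟩
    sumℚ (map (λ A → bernoulli (x zero) b * (probActive (x ∘ suc) A * F (b ∷ A))) S)
      ≡⟨ sumℚ-map-*ˡ (bernoulli (x zero) b) (λ A → probActive (x ∘ suc) A * F (b ∷ A)) S ⟩
    bernoulli (x zero) b * expectation (x ∘ suc) (F ∘ (b ∷_)) ∎
    where
    factor : ∀ A → w (b ∷ A) ≡ bernoulli (x zero) b * (probActive (x ∘ suc) A * F (b ∷ A))
    factor A = trans (cong (_* F (b ∷ A)) (probActive-∷ x b A))
                     (*-assoc (bernoulli (x zero) b) (probActive (x ∘ suc) A) (F (b ∷ A)))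

expectation-monoʳ : ∀ {x : Fin m → ℚ} {F G} → (∀ v → 0ℚ ≤ x v) → (∀ v → x v ≤ 1ℚ) →
                    (∀ A → F A ≤ G A) → expectation x F ≤ expectation x G
expectation-monoʳ {m} {x} {F} {G} 0≤x x≤1 F≤G = sumℚ-map-mono weighted (allSubsets m)
  where
  weighted : ∀ A → probActive x A * F A ≤ probActive x A * G A
  weighted A = *-monoˡ-≤-nonNeg (probActive x A) {{nonNegative (probActive-nonNeg 0≤x x≤1 A)}} (F≤G A)

expectation-monoˡ : ∀ {x y : Fin m → ℚ} {F} → F Preserves _⊆_ ⟶ _≤_ →
                    (∀ v → 0ℚ ≤ x v) → (∀ v → x v ≤ y v) → (∀ v → y v ≤ 1ℚ) →
                    expectation x F ≤ expectation y F
expectation-monoˡ {zero}  _ _ _ _ = ≤-refl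
expectation-monoˡ {suc m} {x} {y} {F} F-mono 0≤x x≤y y≤1 = begin
  expectation x F                                ≡⟨ expectation-∷ x F ⟩
  mix (x zero) (expectation x′ F⁺) (expectation x′ F⁻)
    ≤⟨ mix-mono-≤ (0≤x zero) (x≤1 zero) (induction F⁺ (F-mono ∘ s⊆s)) (induction F⁻ (F-mono ∘ s⊆s)) ⟩
  mix (x zero) (expectation y′ F⁺) (expectation y′ F⁻)
    ≤⟨ mix-monoˡ-≤ (expectation-monoʳ (0≤y ∘ suc) (y≤1 ∘ suc) (λ A → F-mono (out⊆ ⊆-refl))) (x≤y zero) ⟩
  mix (y zero) (expectation y′ F⁺) (expectation y′ F⁻) ≡⟨ expectation-∷ y F ⟨
  expectation y F                                ∎
  where
  open ≤-Reasoning
  x′ = x ∘ suc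
  y′ = y ∘ suc
  F⁺ = F ∘ (inside ∷_)
  F⁻ = F ∘ (outside ∷_)
  x≤1 : ∀ v → x v ≤ 1ℚ
  x≤1 v = ≤-trans (x≤y v) (y≤1 v)
  0≤y : ∀ v → 0ℚ ≤ y v
  0≤y v = ≤-trans (0≤x v) (x≤y v)
  induction : ∀ G → G Preserves _⊆_ ⟶ _≤_ → expectation x′ G ≤ expectation y′ G
  induction G G-mono = expectation-monoˡ G-mono (0≤x ∘ suc) (x≤y ∘ suc) (y≤1 ∘ suc)

lookup-⊆ : ∀ {A B : Subset m} → A ⊆ B → ∀ v → T (lookup A v) → T (lookup B v)
lookup-⊆ {A = A} A⊆B v = from T-≡ ∘ []=⇒lookup ∘ A⊆B ∘ lookup⇒[]= v A ∘ to T-≡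

indicator-mono : ∀ {a b x y} → (T a → T b) → x ≤ y → 0ℚ ≤ y →
                 (if a then x else 0ℚ) ≤ (if b then y else 0ℚ)
indicator-mono {true}  {true}  _   x≤y _   = x≤y
indicator-mono {true}  {false} a⇒b _   _   = ⊥-elim (a⇒b _)
indicator-mono {false} {true}  _   _   0≤y = 0≤y
indicator-mono {false} {false} _   _   _   = ≤-refl

module _ {d : Fin m → Fin m → ℚ} (metric : IsMetric d) where
  open IsMetric metric

  pathLength-nonNeg : ∀ u us → 0ℚ ≤ pathLength d (u ∷ us)
  pathLength-nonNeg u []       = ≤-refl
  pathLength-nonNeg u (v ∷ us) = +-mono-≤ (nonneg u v) (pathLength-nonNeg v us)

  pathLength-detour : ∀ u v ws → pathLength d (u ∷ ws) ≤ d u v + pathLength d (v ∷ ws)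
  pathLength-detour u v []       = ≤-trans (nonneg u v) (≤-reflexive (sym (+-identityʳ (d u v))))
  pathLength-detour u v (w ∷ ws) = ≤-trans (+-monoˡ-≤ (pathLength d (w ∷ ws)) (triangle u v w))
                                           (≤-reflexive (+-assoc (d u v) (d v w) (pathLength d (w ∷ ws))))

  pathLength-mono-⊆ : ∀ {us vs} → us Sublist.⊆ vs →
                      ∀ u → pathLength d (u ∷ us) ≤ pathLength d (u ∷ vs)
  pathLength-mono-⊆ []                       u = ≤-refl
  pathLength-mono-⊆ {us} (v ∷ʳ us⊆vs)        u = ≤-trans (pathLength-detour u v us)
                                                   (+-monoʳ-≤ (d u v) (pathLength-mono-⊆ us⊆vs v))
  pathLength-mono-⊆ (_∷_ {y = v} refl us⊆vs) u = +-monoʳ-≤ (d u v) (pathLength-mono-⊆ us⊆vs v)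

  module _ (r : Fin m) (π : Tour m) where

    visitOrder : List (Fin m)
    visitOrder = map (Inverse.to π) (allFin m)

    activeUpTo : Subset m → Fin m → Fin m → Bool
    activeUpTo A v u = lookup A u ∧ (toℕ (Inverse.from π u) ℕ.≤ᵇ toℕ (Inverse.from π v))

    LAT-nonNeg : ∀ A v → 0ℚ ≤ LAT d r π A v
    LAT-nonNeg A v = pathLength-nonNeg r (filterᵇ (activeUpTo A v) visitOrder)

    LAT-mono : ∀ {A B} → A ⊆ B → ∀ v → LAT d r π A v ≤ LAT d r π B v
    LAT-mono {A} {B} A⊆B v =
      pathLength-mono-⊆ (filter⁺ (T? ∘ activeUpTo A v) (T? ∘ activeUpTo B v) keep
                                  (Sublist.⊆-refl {x = visitOrder})) r
      where
      keep : ∀ {u u′} → u ≡ u′ → T (activeUpTo A v u) → T (activeUpTo B v u′)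
      keep {u} refl = from T-∧ ∘ map₁ (lookup-⊆ A⊆B u) ∘ to T-∧

    totalLatency-mono : totalLatency d r π Preserves _⊆_ ⟶ _≤_
    totalLatency-mono {A} {B} A⊆B = sumℚ-map-mono
      (λ v → indicator-mono (lookup-⊆ A⊆B v) (LAT-mono A⊆B v) (LAT-nonNeg B v)) (allFin m)

lemma2 : (n : ℕ) (d : Fin (suc n) → Fin (suc n) → ℚ) → IsMetric d →
         (r : Fin (suc n)) (π : Tour (suc n)) → StartsAt π r →
         (q p̄ : Fin (suc n) → ℚ) →
         (∀ v → 0ℚ ≤ q v) → (∀ v → q v ≤ p̄ v) → (∀ v → p̄ v ≤ 1ℚ) →
         expectedLatency d r π q ≤ expectedLatency d r π p̄
-- The tour need not start at the root: monotonicity holds for every tour.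
lemma2 n d metric r π _ q p̄ 0≤q q≤p̄ p̄≤1 =
  expectation-monoˡ (totalLatency-mono metric r π) 0≤q q≤p̄ p̄≤1
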